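{- Let $p$ be a prime with $p-1=2^iq_1^{j_1}q_2^{j_2}$, where $q_1\neq q_2$ are odd primes and $i,j_1,j_2\ge 1$. For any generators $g_1,g_2$ of $\mathbb{Z}_p^*$, exactly one of the following holds: $\mathcal{NI}(g_1)\cap\mathcal{NI}(g_2)=\emptyset$, or $\mathcal{NI}(g_1)=\mathcal{NI}(g_2)$.
   Context: $\mathcal{G}$ is the set of generators of $\mathbb{Z}_p^*$, $\mathcal{R}$ the set of quadratic residues in $\mathbb{Z}_p^*$, $\mathcal{NG}$ the set of quadratic non-residues that are not generators. For $g\in\mathcal{G}$: $\bar{\mathcal{R}}_g=\{r\in\mathcal{R}: gr\in\mathcal{NG}\}$ and $\mathcal{NI}(g)=\bar{\mathcal{R}}_g\cap\bar{\mathcal{R}}_{g^{ -1}}$ (products mod $p$). -}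

module Defs where

open import Data.Nat using (ℕ; zero; suc; _+_; _*_; _∸_; _^_; _≤_; _<_; NonZero)
open import Data.Nat.DivMod using (_%_)
open import Data.Product using (_×_; ∃-syntax)
open import Relation.Nullary using (¬_)
open import Relation.Binary.PropositionalEquality using (_≡_; _≢_)

-- Elements of ℤ_p^* are represented by natural numbers 1 ≤ x < p;
-- products are taken mod p.
module _ (p : ℕ) .{{_ : NonZero p}} where

  Unit : ℕ → Set
  Unit x = 1 ≤ x × x < p

  IsGenerator : ℕ → Set
  IsGenerator g = Unit g × (∀ k → 1 ≤ k → k < p ∸ 1 → (g ^ k) % p ≢ 1)

  IsQR : ℕ → Set
  IsQR r = Unit r × ∃[ x ] (x * x) % p ≡ r

  IsNG : ℕ → Set
  IsNG x = Unit x × ¬ IsQR x × ¬ IsGenerator x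

  IsInverse : ℕ → ℕ → Set
  IsInverse g h = Unit h × (g * h) % p ≡ 1

  InRbar : ℕ → ℕ → Set
  InRbar g r = IsQR r × IsNG ((g * r) % p)

  InNI : ℕ → ℕ → Set
  InNI g r = InRbar g r × ∃[ h ] (IsInverse g h × InRbar h r)

  NIDisjoint : ℕ → ℕ → Set
  NIDisjoint g₁ g₂ = ∀ r → ¬ (InNI g₁ r × InNI g₂ r)

  NIEqual : ℕ → ℕ → Set
  NIEqual g₁ g₂ = ∀ r → (InNI g₁ r → InNI g₂ r) × (InNI g₂ r → InNI g₁ r)

-- Fix g = g₁ and write every unit as g^e, the exponent e being read modulo n = p - 1. Then g^e is a
-- quadratic residue iff e is even and a generator iff e is prime to n, so for odd e it lies in 𝒩𝒢 iff
-- q₁ ∣ e or q₂ ∣ e. For a generator g^s with inverse g^t (so n ∣ s + t) and even e, g^e ∈ 𝒩ℐ(g^s) iff one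
-- of q₁, q₂ divides s + e and the other divides t + e; no odd prime dividing n can divide both, since it
-- would divide 2s. If s₂ ≡ s₁ or s₂ ≡ -s₁ modulo q₁ q₂ this condition is the same for s₁ and s₂, and an
-- exponent satisfying it for both forces one of these congruences; so 𝒩ℐ(g^s₁) and 𝒩ℐ(g^s₂) are equal or
-- disjoint. The Chinese remainder theorem gives an even e satisfying the condition, so 𝒩ℐ(g^s) is never
-- empty and the two alternatives exclude each other.

module Submission where

open import Defs
open import Data.Empty using (⊥; ⊥-elim)
open import Data.Fin using (Fin; toℕ; fromℕ<; punchOut)
open import Data.Fin.Properties
  using (any?; punchOut-injective; injective⇒≤; toℕ<n; toℕ-fromℕ<; toℕ-injective; fromℕ<-injective)
  renaming (_≟_ to _≟ᶠ_)
open import Data.Nat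
  using ( ℕ; zero; suc; NonZero; >-nonZero; >-nonZero⁻¹; ≢-nonZero⁻¹; nonTrivial⇒n>1; nonTrivial⇒≢1
        ; _+_; _*_; _∸_; _^_; _≤_; _<_; _%_; _/_; z≤n; s≤s; z<s)
open import Data.Nat.Properties
open import Data.Nat.DivMod
open import Data.Nat.Divisibility
open import Data.Nat.Coprimality using (Coprime; coprime-divisor; coprime-Bézout)
import Data.Nat.Coprimality as Coprime
open import Data.Nat.GCD using (module Bézout)
open import Data.Nat.Primality
  using (Prime; euclidsLemma; prime⇒irreducible; prime[2]; prime⇒nonZero; prime⇒nonTrivial)
open import Data.Nat.Solver using (module +-*-Solver)
open +-*-Solver using (solve; _:=_; _:+_; _:*_; con)
open import Data.Product using (_×_; _,_; proj₁; proj₂; map₂; ∃; ∃-syntax)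
open import Data.Sum using (_⊎_; inj₁; inj₂; [_,_])
open import Function using (_∘_)
open import Function.Bundles using (_⇔_; mk⇔; Equivalence)
open import Function.Definitions using (Injective)
open import Relation.Nullary using (¬_; Dec; yes; no; contradiction)
open import Relation.Nullary.Decidable using (_×-dec_; map′)
open import Relation.Binary.PropositionalEquality
  using (_≡_; _≢_; refl; sym; trans; cong; cong₂; subst; module ≡-Reasoning)

open Equivalence using (to; from)
open ≡-Reasoning

injective⇒surjective : ∀ {n} {f : Fin n → Fin n} → Injective _≡_ _≡_ f → ∀ y → ∃[ x ] f x ≡ y
injective⇒surjective {suc m} {f} f-injective y with any? (λ x → f x ≟ᶠ y)
... | yes hit = hit
... | no miss = contradiction (injective⇒≤ punched-injective) (<⇒≱ ≤-refl)
  where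
  y≢f : ∀ x → y ≢ f x
  y≢f x y≡fx = miss (x , sym y≡fx)

  punched : Fin (suc m) → Fin m
  punched x = punchOut (y≢f x)

  punched-injective : Injective _≡_ _≡_ punched
  punched-injective eq = f-injective (punchOut-injective (y≢f _) (y≢f _) eq)

%≡%⇒∣∸ : ∀ {a b d} .{{_ : NonZero d}} → a % d ≡ b % d → d ∣ b ∸ a
%≡%⇒∣∸ {a} {b} {d} eq = divides (b / d ∸ a / d) (begin
  b ∸ a                                     ≡⟨ cong₂ _∸_ (m≡m%n+[m/n]*n b d) (m≡m%n+[m/n]*n a d) ⟩
  (b % d + b / d * d) ∸ (a % d + a / d * d) ≡⟨ cong (λ r → (b % d + b / d * d) ∸ (r + a / d * d)) eq ⟩
  (b % d + b / d * d) ∸ (b % d + a / d * d) ≡⟨ [m+n]∸[m+o]≡n∸o (b % d) (b / d * d) (a / d * d) ⟩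
  b / d * d ∸ a / d * d                     ≡⟨ *-distribʳ-∸ d (b / d) (a / d) ⟨
  (b / d ∸ a / d) * d                       ∎)

^-% : ∀ x k d .{{_ : NonZero d}} → (x % d) ^ k % d ≡ x ^ k % d
^-% x zero    d = refl
^-% x (suc k) d = begin
  (x % d * (x % d) ^ k) % d          ≡⟨ %-distribˡ-* (x % d) ((x % d) ^ k) d ⟩
  (x % d % d * ((x % d) ^ k % d)) % d ≡⟨ cong₂ (λ u v → (u * v) % d) (m%n%n≡m%n x d) (^-% x k d) ⟩
  (x % d * (x ^ k % d)) % d          ≡⟨ %-distribˡ-* x (x ^ k) d ⟨
  (x * x ^ k) % d                    ∎

2∣1+odd*odd : ∀ {m n} → m % 2 ≡ 1 → n % 2 ≡ 1 → 2 ∣ 1 + m * n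
2∣1+odd*odd {m} {n} m-odd n-odd = m%n≡0⇒n∣m (1 + m * n) 2 (begin
  (1 + m * n) % 2                    ≡⟨ %-distribˡ-+ 1 (m * n) 2 ⟩
  (1 + (m * n) % 2) % 2              ≡⟨ cong (λ r → (1 + r) % 2) (%-distribˡ-* m n 2) ⟩
  (1 + (m % 2 * (n % 2)) % 2) % 2    ≡⟨ cong₂ (λ u v → (1 + (u * v) % 2) % 2) m-odd n-odd ⟩
  0                                  ∎)

∣m+n∣n⇒∣m : ∀ {d m n} → d ∣ m + n → d ∣ n → d ∣ m
∣m+n∣n⇒∣m {d} {m} {n} d∣m+n = ∣m+n∣m⇒∣n (subst (d ∣_) (+-comm m n) d∣m+n)

∣-^ : ∀ {m k} → 1 ≤ k → m ∣ m ^ k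
∣-^ {m} {suc k} _ = m∣m*n (m ^ k)

∣-+-comm : ∀ {q a b} → q ∣ a + b → q ∣ b + a
∣-+-comm {q} {a} {b} = subst (q ∣_) (+-comm a b)

-- Read q ∣ a + b as b ≡ -a (mod q): then y ≡ z, as both are ≡ -x.
∣-+-transfer : ∀ {q x y z w} → q ∣ y + x → q ∣ z + x → q ∣ y + w → q ∣ z + w
∣-+-transfer {q} {x} {y} {z} {w} yx zx yw = ∣m+n∣m⇒∣n (subst (q ∣_) regroup (∣m∣n⇒∣m+n zx yw)) yx
  where
  regroup : (z + x) + (y + w) ≡ (y + x) + (z + w)
  regroup = solve 4 (λ x y z w → (z :+ x) :+ (y :+ w) := (y :+ x) :+ (z :+ w)) refl x y z w

odd-prime∣+⇒∣ : ∀ {q s} → Prime q → q % 2 ≡ 1 → q ∣ s + s → q ∣ s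
odd-prime∣+⇒∣ {q} {s} q-prime q-odd q∣s+s
  with euclidsLemma 2 s q-prime (subst (q ∣_) (cong (s +_) (sym (+-identityʳ s))) q∣s+s)
... | inj₂ q∣s = q∣s
... | inj₁ q∣2 with refl ← ≤-antisym (∣⇒≤ q∣2) (nonTrivial⇒n>1 q {{prime⇒nonTrivial q-prime}}) =
  contradiction q-odd λ ()

∣-+-exclusive : ∀ {q s t e} → Prime q → q % 2 ≡ 1 → ¬ q ∣ s → q ∣ s + t → q ∣ s + e → q ∣ t + e → ⊥
∣-+-exclusive {s = s} {t} q-prime q-odd q∤s st se te =
  q∤s (odd-prime∣+⇒∣ q-prime q-odd (∣-+-transfer {y = t} {z = s} te se (∣-+-comm {a = s} st)))

prime∤⇒coprime : ∀ {q m} → Prime q → ¬ q ∣ m → Coprime m q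
prime∤⇒coprime q-prime q∤m (d∣m , d∣q) with prime⇒irreducible q-prime d∣q
... | inj₁ d≡1 = d≡1
... | inj₂ refl = contradiction d∣m q∤m

distinct-primes-coprime : ∀ {m n} → Prime m → Prime n → m ≢ n → Coprime m n
distinct-primes-coprime m-prime n-prime m≢n = prime∤⇒coprime n-prime λ n∣m →
  [ nonTrivial⇒≢1 {{prime⇒nonTrivial n-prime}} , m≢n ∘ sym ] (prime⇒irreducible m-prime n∣m)

prime-divisor⇒¬coprime : ∀ {q m n} → Prime q → q ∣ m → q ∣ n → ¬ Coprime m n
prime-divisor⇒¬coprime q-prime q∣m q∣n m⊥n = nonTrivial⇒≢1 {{prime⇒nonTrivial q-prime}} (m⊥n (q∣m , q∣n))

coprime-* : ∀ {m n o} → Coprime m n → Coprime m o → Coprime m (n * o)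
coprime-* m⊥n m⊥o (d∣m , d∣n*o) =
  m⊥o (d∣m , coprime-divisor (λ (c∣d , c∣n) → m⊥n (∣-trans c∣d d∣m , c∣n)) d∣n*o)

coprime-^ : ∀ {m n} → Coprime m n → ∀ k → Coprime m (n ^ k)
coprime-^ m⊥n zero    (_ , d∣1) = ∣1⇒≡1 d∣1
coprime-^ m⊥n (suc k) = coprime-* m⊥n (coprime-^ m⊥n k)

-- The witness works because y n ≡ -1, x m ≡ 0 (mod m) and y n ≡ 0, n' x m ≡ -1 (mod n), where n = 1 + n'.
crt-Bézout : ∀ {m n'} x y → 1 + y * suc n' ≡ x * m → ∀ a b → ∃[ e ] (m ∣ a + e × suc n' ∣ b + e)
crt-Bézout {m} {n'} x y 1+yn≡xm a b =
  a * (y * n) + n' * b * (x * m) ,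
  divides (a * x + n' * b * x) (begin
    a + (a * (y * n) + n' * b * (x * m))
      ≡⟨ solve 6 (λ a y n n' b xm → a :+ (a :* (y :* n) :+ n' :* b :* xm)
                                 := a :* (con 1 :+ y :* n) :+ n' :* b :* xm) refl a y n n' b (x * m) ⟩
    a * (1 + y * n) + n' * b * (x * m)
      ≡⟨ cong (λ r → a * r + n' * b * (x * m)) 1+yn≡xm ⟩
    a * (x * m) + n' * b * (x * m)
      ≡⟨ solve 5 (λ a x m n' b → a :* (x :* m) :+ n' :* b :* (x :* m)
                              := (a :* x :+ n' :* b :* x) :* m) refl a x m n' b ⟩
    (a * x + n' * b * x) * m ∎) ,
  divides (b + a * y + n' * b * y) (begin
    b + (a * (y * n) + n' * b * (x * m))
      ≡⟨ cong (λ r → b + (a * (y * n) + n' * b * r)) 1+yn≡xm ⟨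
    b + (a * (y * n) + n' * b * (1 + y * n))
      ≡⟨ solve 4 (λ b a y n' → let n = con 1 :+ n' in
                     b :+ (a :* (y :* n) :+ n' :* b :* (con 1 :+ y :* n))
                  := (b :+ a :* y :+ n' :* b :* y) :* n) refl b a y n' ⟩
    (b + a * y + n' * b * y) * n ∎)
  where
  n : ℕ
  n = suc n'

crt : ∀ {m n} .{{_ : NonZero m}} .{{_ : NonZero n}} → Coprime m n → ∀ a b → ∃[ e ] (m ∣ a + e × n ∣ b + e)
crt {m} {suc n'} m⊥n a b with coprime-Bézout m⊥n
... | Bézout.+- x y 1+yn≡xm = crt-Bézout x y 1+yn≡xm a b
crt {suc m'} {n} m⊥n a b | Bézout.-+ x y 1+xm≡yn with crt-Bézout y x 1+xm≡yn b a
... | e , n∣b+e , m∣a+e = e , m∣a+e , n∣b+e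

module ModuloTwoPrimes (q₁ q₂ : ℕ) where

  record Balanced (s t : ℕ) : Set where
    constructor balanced
    field
      q₁∣ : q₁ ∣ s + t
      q₂∣ : q₂ ∣ s + t

  data Split (s t e : ℕ) : Set where
    q₁q₂ : q₁ ∣ s + e → q₂ ∣ t + e → Split s t e
    q₂q₁ : q₂ ∣ s + e → q₁ ∣ t + e → Split s t e

  balanced? : ∀ s t → Dec (Balanced s t)
  balanced? s t =
    map′ (λ (a , b) → balanced a b) (λ (balanced a b) → a , b) ((q₁ ∣? s + t) ×-dec (q₂ ∣? s + t))

  Balanced-comm : ∀ {s t} → Balanced s t → Balanced t s
  Balanced-comm {s} (balanced st₁ st₂) = balanced (∣-+-comm {a = s} st₁) (∣-+-comm {a = s} st₂)

  Balanced-shift : ∀ {s₁ t₁ s₂ t₂} → Balanced s₁ t₁ → Balanced s₂ t₁ → Balanced s₂ t₂ → Balanced s₁ t₂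
  Balanced-shift {s₁} {t₁} {s₂} (balanced a₁ a₂) (balanced b₁ b₂) (balanced c₁ c₂) =
    balanced (∣-+-transfer {y = s₂} {z = s₁} b₁ a₁ c₁) (∣-+-transfer {y = s₂} {z = s₁} b₂ a₂ c₂)

  Split-intro : ∀ {s t e} → (q₁ ∣ s + e → q₁ ∣ t + e → ⊥) → (q₂ ∣ s + e → q₂ ∣ t + e → ⊥) →
                q₁ ∣ s + e ⊎ q₂ ∣ s + e → q₁ ∣ t + e ⊎ q₂ ∣ t + e → Split s t e
  Split-intro _   _   (inj₁ se) (inj₂ te) = q₁q₂ se te
  Split-intro _   _   (inj₂ se) (inj₁ te) = q₂q₁ se te
  Split-intro ex₁ _   (inj₁ se) (inj₁ te) = ⊥-elim (ex₁ se te)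
  Split-intro _   ex₂ (inj₂ se) (inj₂ te) = ⊥-elim (ex₂ se te)

  Split-elim : ∀ {s t e} → Split s t e → (q₁ ∣ s + e ⊎ q₂ ∣ s + e) × (q₁ ∣ t + e ⊎ q₂ ∣ t + e)
  Split-elim (q₁q₂ se te) = inj₁ se , inj₂ te
  Split-elim (q₂q₁ se te) = inj₂ se , inj₁ te

  Split-swap : ∀ {s t e} → Split s t e → Split t s e
  Split-swap (q₁q₂ se te) = q₂q₁ te se
  Split-swap (q₂q₁ se te) = q₁q₂ te se

  -- Given Balanced s₁ t₁, Balanced s₂ t₁ says s₂ ≡ s₁ and Balanced t₂ t₁ says s₂ ≡ -s₁ (mod q₁ q₂).
  Split-transport : ∀ {s₁ t₁ s₂ t₂ e} → Balanced s₁ t₁ → Balanced s₂ t₁ → Balanced s₂ t₂ →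
                    Split s₁ t₁ e → Split s₂ t₂ e
  Split-transport {s₁} {t₁} {s₂} {t₂} (balanced a₁ a₂) (balanced b₁ b₂) (balanced c₁ c₂) = transport
    where
    via-s : ∀ {q e} → q ∣ s₁ + t₁ → q ∣ s₂ + t₁ → q ∣ s₁ + e → q ∣ s₂ + e
    via-s = ∣-+-transfer {y = s₁} {z = s₂}

    via-t : ∀ {q e} → q ∣ s₂ + t₁ → q ∣ s₂ + t₂ → q ∣ t₁ + e → q ∣ t₂ + e
    via-t st₁ st₂ = ∣-+-transfer {y = t₁} {z = t₂} (∣-+-comm {a = s₂} st₁) (∣-+-comm {a = s₂} st₂)

    transport : ∀ {e} → Split s₁ t₁ e → Split s₂ t₂ e
    transport (q₁q₂ se te) = q₁q₂ (via-s a₁ b₁ se) (via-t b₂ c₂ te)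
    transport (q₂q₁ se te) = q₂q₁ (via-s a₂ b₂ se) (via-t b₁ c₁ te)

  Split-congruent : ∀ {s₁ t₁ s₂ t₂ e} → Balanced s₁ t₁ → Balanced s₂ t₁ → Balanced s₂ t₂ →
                    Split s₁ t₁ e ⇔ Split s₂ t₂ e
  Split-congruent B₁ S B₂ = mk⇔ (Split-transport B₁ S B₂) (Split-transport B₂ (Balanced-shift B₁ S B₂) B₁)

  Split-common : ∀ {s₁ t₁ s₂ t₂ e} → Balanced s₁ t₁ → Balanced s₂ t₂ →
                 Split s₁ t₁ e → Split s₂ t₂ e → Balanced s₂ t₁ ⊎ Balanced t₂ t₁
  Split-common {s₁} {t₁} {s₂} {t₂} (balanced a₁ a₂) (balanced b₁ b₂) = common
    where
    meet-s : ∀ {q s e} → q ∣ s₁ + t₁ → q ∣ s₁ + e → q ∣ s + e → q ∣ s + t₁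
    meet-s {s = s} st se s'e = ∣-+-transfer {y = s₁} {z = s} se s'e st

    meet-t : ∀ {q s t e} → q ∣ s + t → q ∣ t₁ + e → q ∣ t + e → q ∣ s + t₁
    meet-t {s = s} {t} st te t'e =
      ∣-+-comm {a = t₁} (∣-+-transfer {y = t} {z = t₁} t'e te (∣-+-comm {a = s} st))

    common : ∀ {e} → Split s₁ t₁ e → Split s₂ t₂ e → Balanced s₂ t₁ ⊎ Balanced t₂ t₁
    common (q₁q₂ se te) (q₁q₂ s'e t'e) = inj₁ (balanced (meet-s a₁ se s'e) (meet-t b₂ te t'e))
    common (q₂q₁ se te) (q₂q₁ s'e t'e) = inj₁ (balanced (meet-t b₁ te t'e) (meet-s a₂ se s'e))
    common (q₁q₂ se te) (q₂q₁ s'e t'e) =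
      inj₂ (balanced (meet-s a₁ se t'e) (meet-t (∣-+-comm {a = s₂} b₂) te s'e))
    common (q₂q₁ se te) (q₁q₂ s'e t'e) =
      inj₂ (balanced (meet-t (∣-+-comm {a = s₂} b₁) te s'e) (meet-s a₂ se t'e))

  Split-dichotomy : ∀ {s₁ t₁ s₂ t₂} → Balanced s₁ t₁ → Balanced s₂ t₂ →
                    (∀ e → Split s₁ t₁ e ⇔ Split s₂ t₂ e) ⊎ (∀ e → Split s₁ t₁ e → Split s₂ t₂ e → ⊥)
  Split-dichotomy {s₁} {t₁} {s₂} {t₂} B₁ B₂ with balanced? s₂ t₁ | balanced? t₂ t₁
  ... | yes same | _ = inj₁ λ e → Split-congruent B₁ same B₂
  ... | no _ | yes opposite = inj₁ λ e →
    let E = Split-congruent B₁ opposite (Balanced-comm B₂) in mk⇔ (Split-swap ∘ to E) (from E ∘ Split-swap)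
  ... | no differ | no differ′ = inj₂ λ e x y → [ differ , differ′ ] (Split-common B₁ B₂ x y)

  -- Adding the multiple e₀ q₁ q₂ keeps both congruences and makes the exponent even.
  Split-even : Prime q₁ → Prime q₂ → q₁ ≢ q₂ → q₁ % 2 ≡ 1 → q₂ % 2 ≡ 1 →
               ∀ s t → ∃[ e ] (2 ∣ e × Split s t e)
  Split-even q₁-prime q₂-prime q₁≢q₂ q₁-odd q₂-odd s t
    with e₀ , se₀ , te₀ ← crt {{prime⇒nonZero q₁-prime}} {{prime⇒nonZero q₂-prime}}
                              (distinct-primes-coprime q₁-prime q₂-prime q₁≢q₂) s t =
    e₀ + e₀ * (q₁ * q₂) ,
    subst (2 ∣_) (*-suc e₀ (q₁ * q₂)) (∣n⇒∣m*n e₀ (2∣1+odd*odd {q₁} {q₂} q₁-odd q₂-odd)) ,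
    q₁q₂ (shift se₀ (∣n⇒∣m*n e₀ (m∣m*n q₂))) (shift te₀ (∣n⇒∣m*n e₀ (n∣m*n q₁)))
    where
    shift : ∀ {q a} → q ∣ a + e₀ → q ∣ e₀ * (q₁ * q₂) → q ∣ a + (e₀ + e₀ * (q₁ * q₂))
    shift {q} {a} ae₀ q∣k = subst (q ∣_) (+-assoc a e₀ (e₀ * (q₁ * q₂))) (∣m∣n⇒∣m+n ae₀ q∣k)

module Units (p : ℕ) .{{_ : NonZero p}} (p-prime : Prime p) where

  1<p : 1 < p
  1<p = nonTrivial⇒n>1 p {{prime⇒nonTrivial p-prime}}

  unit-pred< : ∀ {u} → Unit p u → u ∸ 1 < p ∸ 1
  unit-pred< (1≤u , u<p) = ∸-monoˡ-< u<p 1≤u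

  unit-pred-injective : ∀ {u v} → Unit p u → Unit p v → u ∸ 1 ≡ v ∸ 1 → u ≡ v
  unit-pred-injective (1≤u , _) (1≤v , _) = pred-injective {{>-nonZero 1≤u}} {{>-nonZero 1≤v}}

  unit⇒∤ : ∀ {x} → Unit p x → ¬ p ∣ x
  unit⇒∤ (1≤x , x<p) p∣x = <⇒≱ x<p (∣⇒≤ {{>-nonZero 1≤x}} p∣x)

  ∤⇒unit : ∀ {x} → ¬ p ∣ x → Unit p (x % p)
  ∤⇒unit {x} p∤x = n≢0⇒n>0 (p∤x ∘ m%n≡0⇒n∣m x p) , m%n<n x p

  square-root-unit : ∀ {x r} → 1 ≤ r → (x * x) % p ≡ r → Unit p (x % p)
  square-root-unit {x} 1≤r x²≡r = ∤⇒unit λ p∣x →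
    n>0⇒n≢0 1≤r (trans (sym x²≡r) (n∣m⇒m%n≡0 (x * x) p (∣m⇒∣m*n x p∣x)))

  *-cancelˡ-%-≤ : ∀ {x y z} → ¬ p ∣ x → y ≤ z → (x * y) % p ≡ (x * z) % p → y % p ≡ z % p
  *-cancelˡ-%-≤ {x} {y} {z} p∤x y≤z eq
    with euclidsLemma x (z ∸ y) p-prime (subst (p ∣_) (sym (*-distribˡ-∸ x z y)) (%≡%⇒∣∸ eq))
  ... | inj₁ p∣x = contradiction p∣x p∤x
  ... | inj₂ p∣z∸y = begin
    y % p             ≡⟨ %-remove-+ʳ y p∣z∸y ⟨
    (y + (z ∸ y)) % p ≡⟨ cong (_% p) (m+[n∸m]≡n y≤z) ⟩
    z % p             ∎

  *-cancelˡ-% : ∀ {x y z} → ¬ p ∣ x → (x * y) % p ≡ (x * z) % p → y % p ≡ z % p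
  *-cancelˡ-% {y = y} {z} p∤x eq with ≤-total y z
  ... | inj₁ y≤z = *-cancelˡ-%-≤ p∤x y≤z eq
  ... | inj₂ z≤y = sym (*-cancelˡ-%-≤ p∤x z≤y (sym eq))

  inverse⇒∤ : ∀ {γ h} → IsInverse p γ h → ¬ p ∣ γ
  inverse⇒∤ {γ} {h} (_ , γh≡1) p∣γ =
    contradiction (trans (sym γh≡1) (n∣m⇒m%n≡0 (γ * h) p (∣m⇒∣m*n h p∣γ))) λ ()

  inverse-unique : ∀ {γ h h′} → IsInverse p γ h → IsInverse p γ h′ → h ≡ h′
  inverse-unique {γ} {h} {h′} inv@((_ , h<p) , γh≡1) ((_ , h′<p) , γh′≡1) = begin
    h      ≡⟨ m<n⇒m%n≡m h<p ⟨
    h % p  ≡⟨ *-cancelˡ-% {γ} (inverse⇒∤ {γ} inv) (trans γh≡1 (sym γh′≡1)) ⟩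
    h′ % p ≡⟨ m<n⇒m%n≡m h′<p ⟩
    h′     ∎

  NI⇔Rbar-inverse : ∀ {γ h r} → IsInverse p γ h → InNI p γ r ⇔ (InRbar p γ r × InRbar p h r)
  NI⇔Rbar-inverse {γ} {h} {r} inv = mk⇔
    (λ (γr , h′ , inv′ , h′r) → γr , subst (λ k → InRbar p k r) (inverse-unique {γ} inv′ inv) h′r)
    (λ (γr , hr) → γr , h , inv , hr)

  NI-unit : ∀ {γ r} → InNI p γ r → Unit p r
  NI-unit (((r-unit , _) , _) , _) = r-unit

  exactly-one : ∀ {γ₁ γ₂} → ∃ (InNI p γ₁) → NIEqual p γ₁ γ₂ ⊎ NIDisjoint p γ₁ γ₂ →
                (NIDisjoint p γ₁ γ₂ × ¬ NIEqual p γ₁ γ₂) ⊎ (NIEqual p γ₁ γ₂ × ¬ NIDisjoint p γ₁ γ₂)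
  exactly-one (r , r∈) (inj₁ equal)    = inj₂ (equal , λ disjoint → disjoint r (r∈ , proj₁ (equal r) r∈))
  exactly-one (r , r∈) (inj₂ disjoint) = inj₁ (disjoint , λ equal → disjoint r (r∈ , proj₁ (equal r) r∈))

  module Cyclic (g : ℕ) (g-generator : IsGenerator p g) where

    n : ℕ
    n = p ∸ 1

    instance
      n-nonZero : NonZero n
      n-nonZero = >-nonZero (m<n⇒0<n∸m 1<p)

    pow : ℕ → ℕ
    pow e = g ^ e % p

    p∤g^ : ∀ e → ¬ p ∣ g ^ e
    p∤g^ zero    p∣1 = <⇒≢ 1<p (sym (∣1⇒≡1 p∣1))
    p∤g^ (suc e) p∣g^1+e = [ unit⇒∤ (proj₁ g-generator) , p∤g^ e ] (euclidsLemma g (g ^ e) p-prime p∣g^1+e)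

    pow-unit : ∀ e → Unit p (pow e)
    pow-unit e = ∤⇒unit (p∤g^ e)

    pow-0 : pow 0 ≡ 1
    pow-0 = m<n⇒m%n≡m 1<p

    pow-+ : ∀ a b → pow (a + b) ≡ (pow a * pow b) % p
    pow-+ a b = trans (cong (_% p) (^-distribˡ-+-* g a b)) (%-distribˡ-* (g ^ a) (g ^ b) p)

    pow-* : ∀ a k → pow a ^ k % p ≡ pow (a * k)
    pow-* a k = trans (^-% (g ^ a) k p) (cong (_% p) (^-*-assoc g a k))

    pow≡1⇒≡0 : ∀ {d} → d < n → pow d ≡ 1 → d ≡ 0
    pow≡1⇒≡0 {zero}  _   _        = refl
    pow≡1⇒≡0 {suc d} d<n pow-d≡1 = contradiction pow-d≡1 (proj₂ g-generator (suc d) (s≤s z≤n) d<n)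

    pow-cancel : ∀ {a b} → a ≤ b → pow a ≡ pow b → pow (b ∸ a) ≡ 1
    pow-cancel {a} {b} a≤b pow-a≡pow-b = begin
      pow (b ∸ a) ≡⟨ *-cancelˡ-% (p∤g^ a) (begin
          (g ^ a * g ^ (b ∸ a)) % p ≡⟨ cong (_% p) (^-distribˡ-+-* g a (b ∸ a)) ⟨
          g ^ (a + (b ∸ a)) % p     ≡⟨ cong pow (m+[n∸m]≡n a≤b) ⟩
          pow b                     ≡⟨ pow-a≡pow-b ⟨
          pow a                     ≡⟨ cong (_% p) (*-identityʳ (g ^ a)) ⟨
          (g ^ a * 1) % p           ∎) ⟩
      1 % p       ≡⟨ pow-0 ⟩
      1           ∎

    pow-injective-≤ : ∀ {a b} → a ≤ b → b < n → pow a ≡ pow b → a ≡ b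
    pow-injective-≤ {a} {b} a≤b b<n eq =
      ≤-antisym a≤b (m∸n≡0⇒m≤n (pow≡1⇒≡0 (≤-<-trans (m∸n≤m b a) b<n) (pow-cancel a≤b eq)))

    pow-injective : ∀ {a b} → a < n → b < n → pow a ≡ pow b → a ≡ b
    pow-injective {a} {b} a<n b<n eq with ≤-total a b
    ... | inj₁ a≤b = pow-injective-≤ a≤b b<n eq
    ... | inj₂ b≤a = sym (pow-injective-≤ b≤a a<n (sym eq))

    pow-index : Fin n → Fin n
    pow-index k = fromℕ< (unit-pred< (pow-unit (toℕ k)))

    pow-index-injective : Injective _≡_ _≡_ pow-index
    pow-index-injective {j} {k} eq = toℕ-injective (pow-injective (toℕ<n j) (toℕ<n k)
      (unit-pred-injective (pow-unit (toℕ j)) (pow-unit (toℕ k)) (fromℕ<-injective _ _ _ _ eq)))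

    log : ∀ {u} → Unit p u → ∃[ e ] (e < n × pow e ≡ u)
    log u-unit with k , index-k≡u ← injective⇒surjective pow-index-injective (fromℕ< (unit-pred< u-unit)) =
      toℕ k , toℕ<n k ,
      unit-pred-injective (pow-unit (toℕ k)) u-unit
        (trans (sym (toℕ-fromℕ< _)) (trans (cong toℕ index-k≡u) (toℕ-fromℕ< _)))

    -- Fermat's little theorem for g: pow n is some pow k with k < n, and pow (n ∸ k) ≡ 1 forces k ≡ 0.
    pow-n : pow n ≡ 1
    pow-n with log (pow-unit n)
    ... | zero  , _   , pow-0≡pow-n = trans (sym pow-0≡pow-n) pow-0
    ... | suc k , k<n , eq = contradiction (pow≡1⇒≡0 (∸-monoʳ-< z<s (<⇒≤ k<n)) (pow-cancel (<⇒≤ k<n) eq))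
                                           (n>0⇒n≢0 (m<n⇒0<n∸m k<n))

    pow-∣ : ∀ {e} → n ∣ e → pow e ≡ 1
    pow-∣ (divides c refl) = begin
      pow (c * n)   ≡⟨ cong pow (*-comm c n) ⟩
      pow (n * c)   ≡⟨ pow-* n c ⟨
      pow n ^ c % p ≡⟨ cong (λ x → x ^ c % p) pow-n ⟩
      1 ^ c % p     ≡⟨ cong (_% p) (^-zeroˡ c) ⟩
      1 % p         ≡⟨ pow-0 ⟩
      1             ∎

    pow-% : ∀ a → pow (a % n) ≡ pow a
    pow-% a = begin
      pow (a % n)                         ≡⟨ m%n%n≡m%n (g ^ (a % n)) p ⟨
      pow (a % n) % p                     ≡⟨ cong (_% p) (*-identityʳ (pow (a % n))) ⟨
      (pow (a % n) * 1) % p               ≡⟨ cong (λ x → (pow (a % n) * x) % p) (pow-∣ (n∣m*n (a / n))) ⟨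
      (pow (a % n) * pow (a / n * n)) % p ≡⟨ pow-+ (a % n) (a / n * n) ⟨
      pow (a % n + a / n * n)             ≡⟨ cong pow (m≡m%n+[m/n]*n a n) ⟨
      pow a                               ∎

    pow≡pow⇒%≡% : ∀ {a b} → pow a ≡ pow b → a % n ≡ b % n
    pow≡pow⇒%≡% {a} {b} eq =
      pow-injective (m%n<n a n) (m%n<n b n) (trans (pow-% a) (trans eq (sym (pow-% b))))

    pow≡1⇒∣ : ∀ {e} → pow e ≡ 1 → n ∣ e
    pow≡1⇒∣ {e} pow-e≡1 =
      m%n≡0⇒n∣m e n (trans (pow≡pow⇒%≡% {e} {0} (trans pow-e≡1 (sym pow-0))) (m<n⇒m%n≡m (>-nonZero⁻¹ n)))

    pow≡pow⇒∣⇒∣ : ∀ {q a b} .{{_ : NonZero q}} → q ∣ n → pow a ≡ pow b → q ∣ a → q ∣ b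
    pow≡pow⇒∣⇒∣ {q} {a} {b} q∣n eq q∣a = m%n≡0⇒n∣m b q (begin
      b % q     ≡⟨ m∣n⇒o%n%m≡o%m q n b q∣n ⟨
      b % n % q ≡⟨ cong (_% q) (pow≡pow⇒%≡% eq) ⟨
      a % n % q ≡⟨ m∣n⇒o%n%m≡o%m q n a q∣n ⟩
      a % q     ≡⟨ n∣m⇒m%n≡0 a q q∣a ⟩
      0         ∎)

    QR⇒even : ∀ {e} → 2 ∣ n → IsQR p (pow e) → 2 ∣ e
    QR⇒even {e} 2∣n ((1≤pow-e , _) , x , x²≡pow-e)
      with a , _ , pow-a≡x%p ← log (square-root-unit 1≤pow-e x²≡pow-e) =
      pow≡pow⇒∣⇒∣ 2∣n pow-[a+a]≡pow-e 2∣a+a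
      where
      pow-[a+a]≡pow-e : pow (a + a) ≡ pow e
      pow-[a+a]≡pow-e = begin
        pow (a + a)               ≡⟨ pow-+ a a ⟩
        (pow a * pow a) % p       ≡⟨ cong (λ y → (y * y) % p) pow-a≡x%p ⟩
        (x % p * (x % p)) % p     ≡⟨ %-distribˡ-* x x p ⟨
        (x * x) % p               ≡⟨ x²≡pow-e ⟩
        pow e                     ∎

      2∣a+a : 2 ∣ a + a
      2∣a+a = divides a (trans (cong (a +_) (sym (+-identityʳ a))) (*-comm 2 a))

    even⇒QR : ∀ {e} → 2 ∣ e → IsQR p (pow e)
    even⇒QR (divides c refl) = pow-unit (c * 2) , g ^ c , (begin
      (g ^ c * g ^ c) % p ≡⟨ cong (_% p) (^-distribˡ-+-* g c c) ⟨
      pow (c + c)         ≡⟨ cong (λ k → pow (c + k)) (+-identityʳ c) ⟨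
      pow (2 * c)         ≡⟨ cong pow (*-comm 2 c) ⟩
      pow (c * 2)         ∎)

    generator⇒coprime : ∀ {e} → IsGenerator p (pow e) → Coprime e n
    generator⇒coprime _ {zero} (_ , 0∣n) = contradiction (0∣⇒≡0 0∣n) (≢-nonZero⁻¹ n)
    generator⇒coprime _ {1} _ = refl
    generator⇒coprime {e} (_ , order) {d@(suc (suc _))} (d∣e , d∣n) =
      contradiction (trans (pow-* e (n / d)) (pow-∣ n∣e*[n/d]))
                    (order (n / d) (m≥n⇒m/n>0 (∣⇒≤ d∣n)) (m/n<m n d (s≤s (s≤s z≤n))))
      where
      n∣e*[n/d] : n ∣ e * (n / d)
      n∣e*[n/d] = subst (_∣ e * (n / d)) (m*[n/m]≡n d∣n) (*-monoˡ-∣ (n / d) d∣e)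

    coprime⇒generator : ∀ {e} → Coprime e n → IsGenerator p (pow e)
    coprime⇒generator {e} e⊥n = pow-unit e , λ k 1≤k k<n pow-e^k≡1 →
      let n∣e*k = pow≡1⇒∣ (trans (sym (pow-* e k)) pow-e^k≡1)
      in <⇒≱ k<n (∣⇒≤ {{>-nonZero 1≤k}} (coprime-divisor (Coprime.sym e⊥n) n∣e*k))

    NG⇔odd∧¬coprime : ∀ {e} → 2 ∣ n → IsNG p (pow e) ⇔ (¬ 2 ∣ e × ¬ Coprime e n)
    NG⇔odd∧¬coprime {e} 2∣n = mk⇔
      (λ (_ , ¬QR , ¬generator) → ¬QR ∘ even⇒QR , ¬generator ∘ coprime⇒generator)
      (λ (odd , ¬coprime) → pow-unit e , odd ∘ QR⇒even 2∣n , ¬coprime ∘ generator⇒coprime)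

    pow-inverse : ∀ {s t} → n ∣ s + t → IsInverse p (pow s) (pow t)
    pow-inverse {s} {t} n∣s+t = pow-unit t , trans (sym (pow-+ s t)) (pow-∣ n∣s+t)

    generator-log : ∀ {γ} → IsGenerator p γ → ∃[ s ] ∃[ t ] (pow s ≡ γ × Coprime s n × n ∣ s + t)
    generator-log γ-generator with s , s<n , pow-s≡γ ← log (proj₁ γ-generator) =
      s , n ∸ s , pow-s≡γ , generator⇒coprime (subst (IsGenerator p) (sym pow-s≡γ) γ-generator) ,
      subst (n ∣_) (sym (m+[n∸m]≡n (<⇒≤ s<n))) ∣-refl

    NI-⊆ : ∀ {γ₁ γ₂} → (∀ e → InNI p γ₁ (pow e) → InNI p γ₂ (pow e)) → ∀ r → InNI p γ₁ r → InNI p γ₂ r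
    NI-⊆ {γ₁} ⊆-on-pow r r∈ with e , _ , refl ← log (NI-unit {γ₁} r∈) = ⊆-on-pow e r∈

    NI-disjoint : ∀ {γ₁ γ₂} → (∀ e → InNI p γ₁ (pow e) → InNI p γ₂ (pow e) → ⊥) → NIDisjoint p γ₁ γ₂
    NI-disjoint {γ₁} apart r (r∈₁ , r∈₂) with e , _ , refl ← log (NI-unit {γ₁} r∈₁) = apart e r∈₁ r∈₂

    module TwoOddPrimes {q₁ q₂ i j₁ j₂ : ℕ}
                        (q₁-prime : Prime q₁) (q₂-prime : Prime q₂) (q₁≢q₂ : q₁ ≢ q₂)
                        (q₁-odd : q₁ % 2 ≡ 1) (q₂-odd : q₂ % 2 ≡ 1)
                        (1≤i : 1 ≤ i) (1≤j₁ : 1 ≤ j₁) (1≤j₂ : 1 ≤ j₂)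
                        (n≡ : n ≡ 2 ^ i * q₁ ^ j₁ * q₂ ^ j₂) where

      open ModuloTwoPrimes q₁ q₂

      2∣n : 2 ∣ n
      2∣n = subst (2 ∣_) (sym n≡) (∣m⇒∣m*n (q₂ ^ j₂) (∣m⇒∣m*n (q₁ ^ j₁) (∣-^ 1≤i)))

      q₁∣n : q₁ ∣ n
      q₁∣n = subst (q₁ ∣_) (sym n≡) (∣m⇒∣m*n (q₂ ^ j₂) (∣n⇒∣m*n (2 ^ i) (∣-^ 1≤j₁)))

      q₂∣n : q₂ ∣ n
      q₂∣n = subst (q₂ ∣_) (sym n≡) (∣n⇒∣m*n (2 ^ i * q₁ ^ j₁) (∣-^ 1≤j₂))

      coprime-to-n : ∀ {x} → ¬ 2 ∣ x → ¬ q₁ ∣ x → ¬ q₂ ∣ x → Coprime x n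
      coprime-to-n {x} 2∤x q₁∤x q₂∤x = subst (Coprime x) (sym n≡)
        (coprime-* (coprime-* (coprime-^ (prime∤⇒coprime prime[2] 2∤x) i)
                              (coprime-^ (prime∤⇒coprime q₁-prime q₁∤x) j₁))
                   (coprime-^ (prime∤⇒coprime q₂-prime q₂∤x) j₂))

      NG⇔odd∧q∣ : ∀ {x} → IsNG p (pow x) ⇔ (¬ 2 ∣ x × (q₁ ∣ x ⊎ q₂ ∣ x))
      NG⇔odd∧q∣ {x} = mk⇔
        (λ x-NG → let 2∤x , ¬coprime = to (NG⇔odd∧¬coprime 2∣n) x-NG in 2∤x , q∣x 2∤x ¬coprime)
        (λ (2∤x , q∣x) → from (NG⇔odd∧¬coprime 2∣n)
          (2∤x , [ (λ q₁∣x → prime-divisor⇒¬coprime q₁-prime q₁∣x q₁∣n)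
                 , (λ q₂∣x → prime-divisor⇒¬coprime q₂-prime q₂∣x q₂∣n) ] q∣x))
        where
        q∣x : ¬ 2 ∣ x → ¬ Coprime x n → q₁ ∣ x ⊎ q₂ ∣ x
        q∣x 2∤x ¬coprime with q₁ ∣? x | q₂ ∣? x
        ... | yes q₁∣x | _        = inj₁ q₁∣x
        ... | no _     | yes q₂∣x = inj₂ q₂∣x
        ... | no q₁∤x  | no q₂∤x  = ⊥-elim (¬coprime (coprime-to-n 2∤x q₁∤x q₂∤x))

      balanced-by-n : ∀ {s t} → n ∣ s + t → Balanced s t
      balanced-by-n n∣s+t = balanced (∣-trans q₁∣n n∣s+t) (∣-trans q₂∣n n∣s+t)

      NI-pow : ∀ {s t e} → Coprime s n → n ∣ s + t → InNI p (pow s) (pow e) ⇔ (2 ∣ e × Split s t e)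
      NI-pow {s} {t} {e} s⊥n n∣s+t = mk⇔
        (λ e∈ → let (e-QR , NG-s) , (_ , NG-t) = to NI⇔Rbar e∈ in
          QR⇒even 2∣n e-QR , Split-intro (exclusive q₁-prime q₁-odd q₁∣n) (exclusive q₂-prime q₂-odd q₂∣n)
                                         (NG⇒q∣ NG-s) (NG⇒q∣ NG-t))
        (λ (2∣e , split) → let q∣s+e , q∣t+e = Split-elim split in
          from NI⇔Rbar ((even⇒QR 2∣e , q∣⇒NG 2∤s 2∣e q∣s+e) , (even⇒QR 2∣e , q∣⇒NG 2∤t 2∣e q∣t+e)))
        where
        NI⇔Rbar : InNI p (pow s) (pow e) ⇔ (InRbar p (pow s) (pow e) × InRbar p (pow t) (pow e))
        NI⇔Rbar = NI⇔Rbar-inverse {pow s} (pow-inverse {s} {t} n∣s+t)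

        2∤s : ¬ 2 ∣ s
        2∤s 2∣s = prime-divisor⇒¬coprime prime[2] 2∣s 2∣n s⊥n

        2∤t : ¬ 2 ∣ t
        2∤t 2∣t = 2∤s (∣m+n∣n⇒∣m (∣-trans 2∣n n∣s+t) 2∣t)

        exclusive : ∀ {q} → Prime q → q % 2 ≡ 1 → q ∣ n → q ∣ s + e → q ∣ t + e → ⊥
        exclusive q-prime q-odd q∣n = ∣-+-exclusive q-prime q-odd
          (λ q∣s → prime-divisor⇒¬coprime q-prime q∣s q∣n s⊥n) (∣-trans q∣n n∣s+t)

        NG⇒q∣ : ∀ {a} → IsNG p ((pow a * pow e) % p) → q₁ ∣ a + e ⊎ q₂ ∣ a + e
        NG⇒q∣ {a} a+e-NG = proj₂ (to NG⇔odd∧q∣ (subst (IsNG p) (sym (pow-+ a e)) a+e-NG))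

        q∣⇒NG : ∀ {a} → ¬ 2 ∣ a → 2 ∣ e → q₁ ∣ a + e ⊎ q₂ ∣ a + e → IsNG p ((pow a * pow e) % p)
        q∣⇒NG {a} 2∤a 2∣e q∣a+e =
          subst (IsNG p) (pow-+ a e) (from NG⇔odd∧q∣ ((λ 2∣a+e → 2∤a (∣m+n∣n⇒∣m 2∣a+e 2∣e)) , q∣a+e))

      NI-pow-⊆ : ∀ {s₁ t₁ s₂ t₂} → Coprime s₁ n → n ∣ s₁ + t₁ → Coprime s₂ n → n ∣ s₂ + t₂ →
                 (∀ e → Split s₁ t₁ e → Split s₂ t₂ e) → ∀ r → InNI p (pow s₁) r → InNI p (pow s₂) r
      NI-pow-⊆ {s₁} {t₁} {s₂} {t₂} s₁⊥n n∣s₁+t₁ s₂⊥n n∣s₂+t₂ ⊆-Split =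
        NI-⊆ {pow s₁} {pow s₂} λ e →
          from (NI-pow s₂⊥n n∣s₂+t₂) ∘ map₂ (⊆-Split e) ∘ to (NI-pow s₁⊥n n∣s₁+t₁)

      NI-equal-or-disjoint : ∀ {γ₁ γ₂} → IsGenerator p γ₁ → IsGenerator p γ₂ →
                             NIEqual p γ₁ γ₂ ⊎ NIDisjoint p γ₁ γ₂
      NI-equal-or-disjoint γ₁-generator γ₂-generator
        with s₁ , t₁ , refl , s₁⊥n , n∣s₁+t₁ ← generator-log γ₁-generator
           | s₂ , t₂ , refl , s₂⊥n , n∣s₂+t₂ ← generator-log γ₂-generator
        with Split-dichotomy (balanced-by-n n∣s₁+t₁) (balanced-by-n n∣s₂+t₂)
      ... | inj₁ same = inj₁ λ r → NI-pow-⊆ s₁⊥n n∣s₁+t₁ s₂⊥n n∣s₂+t₂ (to ∘ same) r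
                                 , NI-pow-⊆ s₂⊥n n∣s₂+t₂ s₁⊥n n∣s₁+t₁ (from ∘ same) r
      ... | inj₂ apart = inj₂ (NI-disjoint {pow s₁} {pow s₂} λ e e∈₁ e∈₂ →
        apart e (proj₂ (to (NI-pow s₁⊥n n∣s₁+t₁) e∈₁)) (proj₂ (to (NI-pow s₂⊥n n∣s₂+t₂) e∈₂)))

      NI-nonempty : ∀ {γ} → IsGenerator p γ → ∃ (InNI p γ)
      NI-nonempty γ-generator
        with s , t , refl , s⊥n , n∣s+t ← generator-log γ-generator
        with e , 2∣e , split ← Split-even q₁-prime q₂-prime q₁≢q₂ q₁-odd q₂-odd s t =
        pow e , from (NI-pow s⊥n n∣s+t) (2∣e , split)

theorem4p1 : (p q₁ q₂ i j₁ j₂ : ℕ) → .{{_ : NonZero p}} → Prime p → Prime q₁ → Prime q₂ → q₁ ≢ q₂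
    → q₁ % 2 ≡ 1 → q₂ % 2 ≡ 1 → 1 ≤ i → 1 ≤ j₁ → 1 ≤ j₂
    → p ∸ 1 ≡ 2 ^ i * q₁ ^ j₁ * q₂ ^ j₂
    → (g₁ g₂ : ℕ) → IsGenerator p g₁ → IsGenerator p g₂
    → (NIDisjoint p g₁ g₂ × ¬ NIEqual p g₁ g₂) ⊎ (NIEqual p g₁ g₂ × ¬ NIDisjoint p g₁ g₂)
theorem4p1 p q₁ q₂ i j₁ j₂ p-prime q₁-prime q₂-prime q₁≢q₂ q₁-odd q₂-odd 1≤i 1≤j₁ 1≤j₂ p-1≡
           g₁ g₂ g₁-generator g₂-generator =
  exactly-one {g₁} {g₂} (NI-nonempty g₁-generator) (NI-equal-or-disjoint g₁-generator g₂-generator)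
  where
  open Units p p-prime
  open Cyclic g₁ g₁-generator
  open TwoOddPrimes q₁-prime q₂-prime q₁≢q₂ q₁-odd q₂-odd 1≤i 1≤j₁ 1≤j₂ p-1≡
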